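{- Let $G$ be a (simple) graph on $30$ vertices such that every set of four vertices of $G$ spans at least three edges. Then $G$ has a vertex of degree at least $16$. -}

module Defs where

open import Data.Nat using (ℕ; _+_; _≤_)
open import Data.Bool using (Bool; true; false)
open import Data.Fin using (Fin)
open import Data.List using (List; filter; length; allFin)
open import Data.Bool.Properties using (T?)
open import Relation.Binary.PropositionalEquality using (_≡_; _≢_)
open import Relation.Nullary using (¬_)

record SimpleGraph (n : ℕ) : Set where
  field
    Adj   : Fin n → Fin n → Bool
    sym   : ∀ u v → Adj u v ≡ Adj v u
    irrefl : ∀ v → Adj v v ≡ false

open SimpleGraph public

edge# : ∀ {n} → SimpleGraph n → Fin n → Fin n → ℕ
edge# G u v with Adj G u v
... | true  = 1
... | false = 0

degree : ∀ {n} → SimpleGraph n → Fin n → ℕ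
degree G v = length (filter (λ u → T? (Adj G v u)) (allFin _))

-- number of edges spanned by the four vertices a, b, c, d
-- (meaningful when they are pairwise distinct)
edgesAmong4 : ∀ {n} → SimpleGraph n → Fin n → Fin n → Fin n → Fin n → ℕ
edgesAmong4 G a b c d =
  edge# G a b + edge# G a c + edge# G a d
  + edge# G b c + edge# G b d + edge# G c d

Every4SetSpans≥3 : ∀ {n} → SimpleGraph n → Set
Every4SetSpans≥3 G = ∀ a b c d →
  a ≢ b → a ≢ c → a ≢ d → b ≢ c → b ≢ d → c ≢ d →
  3 ≤ edgesAmong4 G a b c d

module Submission where

-- Suppose every degree is at most 15 and pick a vertex v with two non-neighbours a, b.
-- Any further vertex x spans with v, a, b a 4-set that already misses the edges va and vb,
-- so x is adjacent to at least two of v, a, b.  Counting, for every x, its neighbours among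
-- v, a, b gives 2 · 30 ≤ deg v + deg a + deg b + 6 ≤ 51, a contradiction.

open import Defs
open import Data.Nat using (_≤_)
open import Data.Fin using (Fin)
open import Data.Product using (∃)

open import Data.Bool using (Bool; true; false; not; _∧_; _∨_; T)
open import Data.Bool.Properties using (T?; T-∧; T-not-≡)
open import Data.Empty using (⊥-elim)
open import Data.Fin using (zero; suc)
open import Data.Fin.Properties using (_≟_; any?)
open import Data.List using (List; []; _∷_; [_]; length; filter; tabulate)
open import Data.List.Membership.Propositional using (_∈_; _∉_)
open import Data.List.Relation.Unary.Any using (here; there)
open import Data.Nat using (ℕ; zero; suc; _+_; _*_; _<_; z≤n; s≤s; _≤?_)
open import Data.Nat.Properties hiding (_≟_)
open import Data.Nat.Solver using (module +-*-Solver)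
open import Data.Product using (∃₂; _×_; _,_)
open import Function using (_∘_; id; Equivalence)
open import Relation.Binary.PropositionalEquality as ≡ using (_≡_; _≢_; refl; cong; cong₂; trans; subst; module ≡-Reasoning)
open import Relation.Nullary using (Dec; yes; no; does)
open import Relation.Nullary.Decidable using (dec-true)

open import Algebra.Properties.Semiring.Sum +-*-semiring
  using (sum; sum-syntax; ∑-distrib-+; *-distribˡ-sum; sum-cong-≗)

module _ {n : ℕ} where
  open import Data.List.Membership.DecPropositional (_≟_ {n}) public using (_∈?_)

𝟙 : Bool → ℕ
𝟙 true  = 1
𝟙 false = 0

𝟙-∨ : ∀ b c → 𝟙 (b ∨ c) ≤ 𝟙 b + 𝟙 c
𝟙-∨ true  c = s≤s z≤n
𝟙-∨ false c = ≤-refl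

𝟙-not : ∀ b → 𝟙 b + 𝟙 (not b) ≡ 1
𝟙-not true  = refl
𝟙-not false = refl

𝟙-∧-not : ∀ b c → 𝟙 b ≤ 𝟙 (b ∧ not c) + 𝟙 c
𝟙-∧-not true  true  = s≤s z≤n
𝟙-∧-not true  false = s≤s z≤n
𝟙-∧-not false c     = z≤n

∑-const : ∀ n c → ∑[ i < n ] c ≡ n * c
∑-const zero    c = refl
∑-const (suc n) c = cong (c +_) (∑-const n c)

∑-mono-≤ : ∀ {n} {f g : Fin n → ℕ} → (∀ i → f i ≤ g i) → ∑[ i < n ] f i ≤ ∑[ i < n ] g i
∑-mono-≤ {zero}  f≤g = z≤n
∑-mono-≤ {suc n} f≤g = +-mono-≤ (f≤g zero) (∑-mono-≤ (f≤g ∘ suc))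

∑-𝟙-≟ : ∀ {n} (y : Fin n) → ∑[ x < n ] 𝟙 (does (x ≟ y)) ≡ 1
∑-𝟙-≟ {suc n} zero    = cong suc (trans (∑-const n 0) (*-zeroʳ n))
∑-𝟙-≟ {suc n} (suc y) = ∑-𝟙-≟ y

∑-𝟙-∈≤length : ∀ {n} (ys : List (Fin n)) → ∑[ x < n ] 𝟙 (does (x ∈? ys)) ≤ length ys
∑-𝟙-∈≤length {n} []       = ≤-reflexive (trans (∑-const n 0) (*-zeroʳ n))
∑-𝟙-∈≤length {n} (y ∷ ys) = begin
  ∑[ x < n ] 𝟙 (does (x ≟ y) ∨ does (x ∈? ys))              ≤⟨ ∑-mono-≤ (λ x → 𝟙-∨ (does (x ≟ y)) _) ⟩
  ∑[ x < n ] (𝟙 (does (x ≟ y)) + 𝟙 (does (x ∈? ys)))        ≡⟨ ∑-distrib-+ (λ x → 𝟙 (does (x ≟ y))) (λ x → 𝟙 (does (x ∈? ys))) ⟩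
  ∑[ x < n ] 𝟙 (does (x ≟ y)) + ∑[ x < n ] 𝟙 (does (x ∈? ys)) ≤⟨ +-mono-≤ (≤-reflexive (∑-𝟙-≟ y)) (∑-𝟙-∈≤length ys) ⟩
  suc (length ys)                                             ∎
  where open ≤-Reasoning

∑-𝟙-pos⇒∃ : ∀ {n} (p : Fin n → Bool) → 1 ≤ ∑[ x < n ] 𝟙 (p x) → ∃ λ x → T (p x)
∑-𝟙-pos⇒∃ {suc n} p pos with p zero in eq
... | true  = zero , subst T (≡.sym eq) _
... | false with ∑-𝟙-pos⇒∃ (p ∘ suc) pos
...   | x , px = suc x , px

∃-outside : ∀ {n} (p : Fin n → Bool) (ys : List (Fin n)) →
            length ys < ∑[ x < n ] 𝟙 (p x) → ∃ λ x → T (p x) × x ∉ ys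
∃-outside {n} p ys ys<p with ∑-𝟙-pos⇒∃ p∖ys pos
  where
  p∖ys : Fin n → Bool
  p∖ys x = p x ∧ not (does (x ∈? ys))
  pos : 1 ≤ ∑[ x < n ] 𝟙 (p∖ys x)
  pos = +-cancelʳ-≤ (length ys) 1 _ (≤-trans ys<p (begin
    ∑[ x < n ] 𝟙 (p x)                                       ≤⟨ ∑-mono-≤ (λ x → 𝟙-∧-not (p x) _) ⟩
    ∑[ x < n ] (𝟙 (p∖ys x) + 𝟙 (does (x ∈? ys)))              ≡⟨ ∑-distrib-+ (𝟙 ∘ p∖ys) (λ x → 𝟙 (does (x ∈? ys))) ⟩
    ∑[ x < n ] 𝟙 (p∖ys x) + ∑[ x < n ] 𝟙 (does (x ∈? ys))    ≤⟨ +-monoʳ-≤ _ (∑-𝟙-∈≤length ys) ⟩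
    ∑[ x < n ] 𝟙 (p∖ys x) + length ys                         ∎))
    where open ≤-Reasoning
... | x , px∧x∉ys = let px , ¬x∈ys = Equivalence.to T-∧ px∧x∉ys in
  x , px , λ x∈ys → subst (T ∘ not) (dec-true (x ∈? ys) x∈ys) ¬x∈ys

length-filter-tabulate : ∀ {m n} (f : Fin m → Fin n) (p : Fin n → Bool) →
  length (filter (λ x → T? (p x)) (tabulate f)) ≡ ∑[ i < m ] 𝟙 (p (f i))
length-filter-tabulate {zero}  f p = refl
length-filter-tabulate {suc m} f p with p (f zero)
... | true  = cong suc (length-filter-tabulate (f ∘ suc) p)
... | false = length-filter-tabulate (f ∘ suc) p

module _ {n} (G : SimpleGraph n) where

  edge#≡𝟙 : ∀ u w → edge# G u w ≡ 𝟙 (Adj G u w)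
  edge#≡𝟙 u w with Adj G u w
  ... | true  = refl
  ... | false = refl

  edge#≤1 : ∀ u w → edge# G u w ≤ 1
  edge#≤1 u w with Adj G u w
  ... | true  = ≤-refl
  ... | false = z≤n

  degree≡∑edge# : ∀ u → degree G u ≡ ∑[ w < n ] edge# G u w
  degree≡∑edge# u = trans (length-filter-tabulate id (Adj G u)) (sum-cong-≗ (≡.sym ∘ edge#≡𝟙 u))

  degree+non-degree : ∀ u → degree G u + ∑[ w < n ] 𝟙 (not (Adj G u w)) ≡ n
  degree+non-degree u = begin
    degree G u + ∑[ w < n ] 𝟙 (not (Adj G u w))              ≡⟨ cong (_+ ∑[ w < n ] 𝟙 (not (Adj G u w))) (length-filter-tabulate id (Adj G u)) ⟩
    ∑[ w < n ] 𝟙 (Adj G u w) + ∑[ w < n ] 𝟙 (not (Adj G u w)) ≡⟨ ∑-distrib-+ (𝟙 ∘ Adj G u) (𝟙 ∘ not ∘ Adj G u) ⟨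
    ∑[ w < n ] (𝟙 (Adj G u w) + 𝟙 (not (Adj G u w)))         ≡⟨ sum-cong-≗ (𝟙-not ∘ Adj G u) ⟩
    ∑[ w < n ] 1                                              ≡⟨ ∑-const n 1 ⟩
    n * 1                                                     ≡⟨ *-identityʳ n ⟩
    n                                                         ∎
    where open ≡-Reasoning

  three≤non-degree : ∀ v → 3 + degree G v ≤ n → 3 ≤ ∑[ w < n ] 𝟙 (not (Adj G v w))
  three≤non-degree v 3+deg≤n = +-cancelʳ-≤ (degree G v) 3 _
    (≤-trans 3+deg≤n (≤-reflexive (trans (≡.sym (degree+non-degree v)) (+-comm (degree G v) _))))

  two-non-neighbours : ∀ v → 3 + degree G v ≤ n →
    ∃₂ λ a b → v ≢ a × v ≢ b × a ≢ b × Adj G v a ≡ false × Adj G v b ≡ false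
  two-non-neighbours v 3+deg≤n
    with a , ¬va , a∉v   ← ∃-outside (not ∘ Adj G v) [ v ] (≤-trans (n≤1+n 2) (three≤non-degree v 3+deg≤n))
    with b , ¬vb , b∉va ← ∃-outside (not ∘ Adj G v) (v ∷ a ∷ []) (three≤non-degree v 3+deg≤n)
    = a , b , (λ v≡a → a∉v (here (≡.sym v≡a))) , (λ v≡b → b∉va (here (≡.sym v≡b)))
    , (λ a≡b → b∉va (there (here (≡.sym a≡b))))
    , Equivalence.to T-not-≡ ¬va , Equivalence.to T-not-≡ ¬vb

module _ {n} (G : SimpleGraph n) (spans : Every4SetSpans≥3 G) where

  adjacent-to-two : ∀ {v a b x} → v ≢ a → v ≢ b → a ≢ b → x ∉ v ∷ a ∷ b ∷ [] →
    Adj G v a ≡ false → Adj G v b ≡ false →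
    2 ≤ edge# G v x + edge# G a x + edge# G b x
  adjacent-to-two {v} {a} {b} {x} v≢a v≢b a≢b x∉vab va vb = +-cancelˡ-≤ 1 2 _ (begin
    3                                             ≤⟨ spans v a b x v≢a v≢b v≢x a≢b a≢x b≢x ⟩
    edge# G v a + edge# G v b + p + q + r + s     ≡⟨ cong₂ (λ e f → e + f + p + q + r + s) (non-edge va) (non-edge vb) ⟩
    p + q + r + s                                 ≡⟨ solve 4 (λ p q r s → p :+ q :+ r :+ s := q :+ (p :+ r :+ s)) ≡.refl p q r s ⟩
    q + (p + r + s)                               ≤⟨ +-monoˡ-≤ _ (edge#≤1 G a b) ⟩
    1 + (p + r + s)                               ∎)
    where
    open ≤-Reasoning
    open +-*-Solver
    p = edge# G v x
    q = edge# G a b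
    r = edge# G a x
    s = edge# G b x
    non-edge : ∀ {u w} → Adj G u w ≡ false → edge# G u w ≡ 0
    non-edge {u} {w} uw = trans (edge#≡𝟙 G u w) (cong 𝟙 uw)
    v≢x : v ≢ x
    v≢x v≡x = x∉vab (here (≡.sym v≡x))
    a≢x : a ≢ x
    a≢x a≡x = x∉vab (there (here (≡.sym a≡x)))
    b≢x : b ≢ x
    b≢x b≡x = x∉vab (there (there (here (≡.sym b≡x))))

  degree-sum-bound : ∀ {v a b} → v ≢ a → v ≢ b → a ≢ b → Adj G v a ≡ false → Adj G v b ≡ false →
    2 * n ≤ degree G v + degree G a + degree G b + 6
  degree-sum-bound {v} {a} {b} v≢a v≢b a≢b va vb = begin
    2 * n                                       ≡⟨ *-comm 2 n ⟩
    n * 2                                       ≡⟨ ∑-const n 2 ⟨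
    ∑[ x < n ] 2                                ≤⟨ ∑-mono-≤ (λ x → pointwise x (x ∈? L)) ⟩
    ∑[ x < n ] (S x + 2 * 𝟙 (does (x ∈? L)))    ≡⟨ ∑-distrib-+ S (λ x → 2 * 𝟙 (does (x ∈? L))) ⟩
    sum S + ∑[ x < n ] (2 * 𝟙 (does (x ∈? L)))  ≡⟨ cong (sum S +_) (*-distribˡ-sum 2 (λ x → 𝟙 (does (x ∈? L)))) ⟨
    sum S + 2 * ∑[ x < n ] 𝟙 (does (x ∈? L))    ≤⟨ +-monoʳ-≤ (sum S) (*-monoʳ-≤ 2 (∑-𝟙-∈≤length L)) ⟩
    sum S + 6                                   ≡⟨ cong (_+ 6) ∑S≡degrees ⟩
    degree G v + degree G a + degree G b + 6    ∎
    where
    open ≤-Reasoning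
    L = v ∷ a ∷ b ∷ []
    S : Fin n → ℕ
    S x = edge# G v x + edge# G a x + edge# G b x
    -- the correction 2 · [x ∈ L] pays for the vertices v, a, b themselves
    pointwise : ∀ x (x∈?L : Dec (x ∈ L)) → 2 ≤ S x + 2 * 𝟙 (does x∈?L)
    pointwise x (yes _)    = m≤n+m 2 (S x)
    pointwise x (no x∉L) = ≤-trans (adjacent-to-two v≢a v≢b a≢b x∉L va vb) (m≤m+n (S x) 0)
    ∑S≡degrees : sum S ≡ degree G v + degree G a + degree G b
    ∑S≡degrees = begin-equality
      sum S                                                       ≡⟨ ∑-distrib-+ (λ x → edge# G v x + edge# G a x) (edge# G b) ⟩
      ∑[ x < n ] (edge# G v x + edge# G a x) + sum (edge# G b)    ≡⟨ cong (_+ sum (edge# G b)) (∑-distrib-+ (edge# G v) (edge# G a)) ⟩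
      sum (edge# G v) + sum (edge# G a) + sum (edge# G b)         ≡⟨ ≡.sym (cong₂ _+_ (cong₂ _+_ (degree≡∑edge# G v) (degree≡∑edge# G a)) (degree≡∑edge# G b)) ⟩
      degree G v + degree G a + degree G b                        ∎

max-degree-bound : ∀ {n d} (G : SimpleGraph n) → Every4SetSpans≥3 G →
  (∀ v → degree G v ≤ d) → 3 + d ≤ n → 2 * n ≤ 3 * d + 6
max-degree-bound {suc n} {d} G spans deg≤d 3+d≤n =
  bound (two-non-neighbours G zero (≤-trans (+-monoʳ-≤ 3 (deg≤d zero)) 3+d≤n))
  where
  open ≤-Reasoning
  open +-*-Solver
  bound : (∃₂ λ a b → zero ≢ a × zero ≢ b × a ≢ b × Adj G zero a ≡ false × Adj G zero b ≡ false) →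
          2 * suc n ≤ 3 * d + 6
  bound (a , b , v≢a , v≢b , a≢b , va , vb) = begin
    2 * suc n                                    ≤⟨ degree-sum-bound G spans v≢a v≢b a≢b va vb ⟩
    degree G zero + degree G a + degree G b + 6  ≤⟨ +-monoˡ-≤ 6 (+-mono-≤ (+-mono-≤ (deg≤d zero) (deg≤d a)) (deg≤d b)) ⟩
    d + d + d + 6                                ≡⟨ cong (_+ 6) (solve 1 (λ d → d :+ d :+ d := con 3 :* d) ≡.refl d) ⟩
    3 * d + 6                                    ∎

lemma3p3 : (G : SimpleGraph 30) → Every4SetSpans≥3 G → ∃ λ (v : Fin 30) → 16 ≤ degree G v
lemma3p3 G spans with any? (λ v → 16 ≤? degree G v)
... | yes high-degree    = high-degree
... | no ¬high-degree = ⊥-elim (≤⇒≯ (max-degree-bound G spans deg≤15 (m≤m+n 18 12)) (m≤m+n 52 8))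
  where
  deg≤15 : ∀ v → degree G v ≤ 15
  deg≤15 v = ≤-pred (≰⇒> (λ 16≤deg → ¬high-degree (v , 16≤deg)))
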